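{- Let $V$ be a finite set with $|V|\ge2$ and $T:\ell^2(V)\to\ell^2(V)$ a self-adjoint operator with $\langle T1_v,1_u\rangle\in\mathbb Z_{\ge0}$ for all $u,v$ and $\mathrm{vol}_T(\{u\})=d>0$ for all $u$, with $T=P_{\rho_1}+\dots+P_{\rho_d}$ for permutations $\rho_i$ of $V$, with $-d$ not an eigenvalue of $T$. Let $\mathcal G$ be a group acting transitively on $V$ whose induced action on $\ell^2(V)$ commutes with $T^2$, such that no index two subgroup of $\mathcal G$ acts transitively on $V$. Let $\psi=\mathfrak h_{T^2}$ and let $A\subseteq V$, $A\ne\emptyset,V$, satisfy $\mathrm{vol}_{T^2}(A)\le\mathrm{vol}_{T^2}(V\setminus A)$ and $\langle T^21_A,1_{V\setminus A}\rangle=\psi\,\mathrm{vol}_{T^2}(A)$. If $\psi<\frac{\mathfrak h_T}{d}$, then for every $g\in\mathcal G$, $$\mathrm{vol}_T(gA\cup\mathcal N(gA))\ge\mathrm{vol}_T(V\setminus(gA\cup\mathcal N(gA))).$$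
   Context: $\ell^2(V)$: functions $V\to\mathbb C$ with $\langle f,g\rangle=\sum_vf(v)\overline{g(v)}$; $1_F$ indicator, $1_v=1_{\{v\}}$. $P_\rho f(v)=f(\rho^{ -1}v)$; the induced $\mathcal G$-action is $(g\cdot f)(v)=f(g^{ -1}v)$. $\mathrm{vol}_T(F)=\langle T1_V,1_F\rangle$; $\mathfrak h_T=\min_{F\ne\emptyset,V}\frac{\langle T1_F,1_{V\setminus F}\rangle}{\min\{\mathrm{vol}_T(F),\mathrm{vol}_T(V\setminus F)\}}$, and similarly for $T^2$. $\mathcal N(X)=\{v\in V:\langle T1_v,1_X\rangle\ne0\}$. -}

module Defs where

open import Level using (0ℓ)
open import Data.Nat as ℕ using (ℕ; zero; suc)
open import Data.Integer as ℤ using (ℤ; _+_; _*_; -_; _⊓_; +_; 0ℤ)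
open import Data.Rational as ℚ using (ℚ)
open import Data.Fin using (Fin; zero; suc; _≟_)
open import Data.Fin.Permutation using (Permutation′; _⟨$⟩ʳ_; _⟨$⟩ˡ_)
open import Data.Bool using (Bool; true; false; if_then_else_; _∨_; not)
open import Data.Product using (Σ; ∃; _×_; _,_)
open import Data.Sum using (_⊎_)
open import Relation.Nullary using (¬_)
open import Relation.Nullary.Decidable using (⌊_⌋)
open import Relation.Binary.PropositionalEquality using (_≡_)
open import Algebra.Bundles using (Group)
import Data.Integer.Properties as ℤP

-- Real-valued functions on V = Fin n; since every operator involved has
-- integer matrix entries we work with ℤ-valued functions.
Fn : ℕ → Set
Fn n = Fin n → ℤ

Σℤ : ∀ {m} → (Fin m → ℤ) → ℤ
Σℤ {zero}  f = 0ℤ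
Σℤ {suc m} f = f zero + Σℤ (λ i → f (suc i))

⟪_,_⟫ : ∀ {n} → Fn n → Fn n → ℤ
⟪ f , g ⟫ = Σℤ (λ v → f v * g v)

Subset : ℕ → Set
Subset n = Fin n → Bool

𝟙 : ∀ {n} → Subset n → Fn n
𝟙 F v = if F v then + 1 else 0ℤ

full : ∀ {n} → Subset n
full _ = true

⟦_⟧ : ∀ {n} → Fin n → Subset n
⟦ v ⟧ u = ⌊ u ≟ v ⌋

∁ : ∀ {n} → Subset n → Subset n
∁ F v = not (F v)

_∪_ : ∀ {n} → Subset n → Subset n → Subset n
(F ∪ G) v = F v ∨ G v

Proper : ∀ {n} → Subset n → Set
Proper F = (∃ λ v → F v ≡ true) × (∃ λ v → F v ≡ false)

P : ∀ {n} → Permutation′ n → Fn n → Fn n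
P ρ f v = f (ρ ⟨$⟩ˡ v)

Top : ∀ {n d} → (Fin d → Permutation′ n) → Fn n → Fn n
Top ρ f v = Σℤ (λ i → P (ρ i) f v)

_² : ∀ {n} → (Fn n → Fn n) → Fn n → Fn n
(T ²) f = T (T f)

SelfAdjoint : ∀ {n} → (Fn n → Fn n) → Set
SelfAdjoint T = ∀ f g → ⟪ T f , g ⟫ ≡ ⟪ f , T g ⟫

IsEigenvalue : ∀ {n} → (Fn n → Fn n) → ℤ → Set
IsEigenvalue T λ′ = ∃ λ f → (¬ (∀ v → f v ≡ 0ℤ)) × (∀ v → T f v ≡ λ′ * f v)

vol : ∀ {n} → (Fn n → Fn n) → Subset n → ℤ
vol T F = ⟪ T (𝟙 full) , 𝟙 F ⟫

∂ : ∀ {n} → (Fn n → Fn n) → Subset n → ℤ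
∂ T F = ⟪ T (𝟙 F) , 𝟙 (∁ F) ⟫

den : ∀ {n} → (Fn n → Fn n) → Subset n → ℤ
den T F = vol T F ⊓ vol T (∁ F)

toℚ : ℤ → ℚ
toℚ z = z ℚ./ 1

-- h is the Cheeger constant 𝔥_T, i.e. the minimum over proper nonempty F of
-- ∂T(F) / den T(F).  Written as "attained and a lower bound", with the
-- (positive) denominators cleared.
IsCheeger : ∀ {n} → (Fn n → Fn n) → ℚ → Set
IsCheeger T h =
  (∃ λ F → Proper F × (toℚ (∂ T F) ≡ h ℚ.* toℚ (den T F)))
  × (∀ F → Proper F → h ℚ.* toℚ (den T F) ℚ.≤ toℚ (∂ T F))

𝒩 : ∀ {n} → (Fn n → Fn n) → Subset n → Subset n
𝒩 T X v = not ⌊ ⟪ T (𝟙 ⟦ v ⟧) , 𝟙 X ⟫ ℤP.≟ 0ℤ ⌋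

record Action (G : Group 0ℓ 0ℓ) (n : ℕ) : Set where
  open Group G
  field
    act      : Carrier → Fin n → Fin n
    act-ε    : ∀ v → act ε v ≡ v
    act-∙    : ∀ g h v → act (g ∙ h) v ≡ act g (act h v)
    act-cong : ∀ {g h} → g ≈ h → ∀ v → act g v ≡ act h v

module _ {G : Group 0ℓ 0ℓ} {n : ℕ} (α : Action G n) where
  open Group G
  open Action α

  actFn : Carrier → Fn n → Fn n
  actFn g f v = f (act (g ⁻¹) v)

  actSet : Carrier → Subset n → Subset n
  actSet g A v = A (act (g ⁻¹) v)

  TransitiveOn : (Carrier → Set) → Set
  TransitiveOn H = ∀ u v → ∃ λ h → H h × act h u ≡ v

  Transitive : Set
  Transitive = TransitiveOn (λ _ → Data.Unit.⊤)
    where import Data.Unit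

  CommutesWith : (Fn n → Fn n) → Set
  CommutesWith S = ∀ g f v → actFn g (S f) v ≡ S (actFn g f) v

record IsSubgroup (G : Group 0ℓ 0ℓ) (H : Group.Carrier G → Set) : Set where
  open Group G
  field
    resp  : ∀ {x y} → x ≈ y → H x → H y
    has-ε : H ε
    ∙-closed : ∀ {x y} → H x → H y → H (x ∙ y)
    ⁻¹-closed : ∀ {x} → H x → H (x ⁻¹)

-- H has index two: its left cosets are exactly H and aH with a ∉ H
IndexTwo : (G : Group 0ℓ 0ℓ) → (Group.Carrier G → Set) → Set
IndexTwo G H = ∃ λ a → ¬ H a × (∀ x → H x ⊎ H ((a ⁻¹) ∙ x))
  where open Group G

{-# OPTIONS --safe #-}
module Submission where

-- Suppose B = gA ∪ 𝒩(gA) had vol_T(B) < vol_T(V∖B).  Then B is a proper set, so the Cheeger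
-- bound for T gives 𝔥_T vol_T(B) ≤ ⟨T1_B,1_{V∖B}⟩.  A vertex v ∉ B has no T-neighbour in gA, so
-- each T-neighbour of v lying in B lies in 𝒩(gA) and therefore has a T-neighbour in gA: every
-- T-edge leaving B extends to a T²-path leaving gA, i.e. ⟨T1_B,1_{V∖B}⟩ ≤ ⟨T²1_{gA},1_{V∖gA}⟩.
-- By G-invariance this equals ψ vol_{T²}(A) = ψ d vol_T(A) ≤ ψ d vol_T(B), contradicting ψ d < 𝔥_T.

open import Defs
open import Level using (0ℓ)
open import Function using (_∘_)
open import Data.Nat using (ℕ; zero; suc; _≤_; _<_; z≤n; s≤s)
open import Data.Integer using (ℤ; +_; -_; 0ℤ; _+_; _*_; +≤+; +<+) renaming (_≤_ to _≤ℤ_; _<_ to _<ℤ_)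
import Data.Integer as ℤ
import Data.Integer.Properties as ℤP
open import Data.Rational using (ℚ; 0ℚ) renaming (_*_ to _*ℚ_; _<_ to _<ℚ_; _≤_ to _≤ℚ_)
import Data.Rational as ℚ
import Data.Rational.Properties as ℚP
open import Data.Rational.Literals using (fromℤ)
open import Data.Fin using (Fin; zero; suc)
import Data.Fin.Properties as FinP
open import Data.Fin.Permutation using (Permutation′; permutation; _⟨$⟩ʳ_; _⟨$⟩ˡ_)
open import Data.Bool using (true; false; not; _∨_; if_then_else_)
import Data.Bool.Properties as BoolP
open import Data.Product using (∃; _,_)
open import Relation.Nullary using (¬_; yes; no; contradiction)
open import Relation.Nullary.Decidable using (⌊_⌋; ⌊⌋-map′)
open import Relation.Binary.PropositionalEquality
open import Algebra.Bundles using (Group)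
import Algebra.Properties.CommutativeMonoid.Sum as MonoidSum

open MonoidSum ℤP.+-0-commutativeMonoid using (sum; sum-permute)

Σℤ≡sum : ∀ {m} (f : Fin m → ℤ) → Σℤ f ≡ sum f
Σℤ≡sum {zero}  f = refl
Σℤ≡sum {suc m} f = cong (_+_ (f zero)) (Σℤ≡sum (f ∘ suc))

Σℤ-permute : ∀ {m} (f : Fin m → ℤ) (π : Permutation′ m) → Σℤ (f ∘ (π ⟨$⟩ʳ_)) ≡ Σℤ f
Σℤ-permute f π = trans (Σℤ≡sum (f ∘ (π ⟨$⟩ʳ_))) (trans (sym (sum-permute f π)) (sym (Σℤ≡sum f)))

Σℤ-cong : ∀ {m} {f g : Fin m → ℤ} → (∀ i → f i ≡ g i) → Σℤ f ≡ Σℤ g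
Σℤ-cong {zero}  f≡g = refl
Σℤ-cong {suc m} f≡g = cong₂ _+_ (f≡g zero) (Σℤ-cong (f≡g ∘ suc))

Σℤ-zero : ∀ {m} {f : Fin m → ℤ} → (∀ i → f i ≡ 0ℤ) → Σℤ f ≡ 0ℤ
Σℤ-zero {zero}  f≡0 = refl
Σℤ-zero {suc m} f≡0 = cong₂ _+_ (f≡0 zero) (Σℤ-zero (f≡0 ∘ suc))

Σℤ-mono-≤ : ∀ {m} {f g : Fin m → ℤ} → (∀ i → f i ≤ℤ g i) → Σℤ f ≤ℤ Σℤ g
Σℤ-mono-≤ {zero}  f≤g = ℤP.≤-refl
Σℤ-mono-≤ {suc m} f≤g = ℤP.+-mono-≤ (f≤g zero) (Σℤ-mono-≤ (f≤g ∘ suc))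

Σℤ-nonneg : ∀ {m} {f : Fin m → ℤ} → (∀ i → 0ℤ ≤ℤ f i) → 0ℤ ≤ℤ Σℤ f
Σℤ-nonneg {zero}  f≥0 = ℤP.≤-refl
Σℤ-nonneg {suc m} f≥0 = ℤP.+-mono-≤ (f≥0 zero) (Σℤ-nonneg (f≥0 ∘ suc))

Σℤ-term≤ : ∀ {m} {f : Fin m → ℤ} → (∀ i → 0ℤ ≤ℤ f i) → ∀ i → f i ≤ℤ Σℤ f
Σℤ-term≤ {suc m} {f} f≥0 zero =
  subst (_≤ℤ Σℤ f) (ℤP.+-identityʳ (f zero)) (ℤP.+-monoʳ-≤ (f zero) (Σℤ-nonneg (f≥0 ∘ suc)))
Σℤ-term≤ {suc m} {f} f≥0 (suc i) =
  ℤP.≤-trans (Σℤ-term≤ (f≥0 ∘ suc) i)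
    (subst (_≤ℤ Σℤ f) (ℤP.+-identityˡ _) (ℤP.+-monoˡ-≤ (Σℤ (f ∘ suc)) (f≥0 zero)))

Σℤ-const : ∀ {m} (c : ℤ) → Σℤ {m} (λ _ → c) ≡ + m * c
Σℤ-const {zero}  c = refl
Σℤ-const {suc m} c = begin
  c + Σℤ {m} (λ _ → c)  ≡⟨ cong (_+_ c) (Σℤ-const {m} c) ⟩
  c + + m * c           ≡⟨ cong (_+ + m * c) (sym (ℤP.*-identityˡ c)) ⟩
  + 1 * c + + m * c     ≡⟨ sym (ℤP.*-distribʳ-+ c (+ 1) (+ m)) ⟩
  + suc m * c           ∎
  where open ≡-Reasoning

Σℤ-*ˡ : ∀ {m} (c : ℤ) (f : Fin m → ℤ) → Σℤ (λ i → c * f i) ≡ c * Σℤ f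
Σℤ-*ˡ {zero}  c f = sym (ℤP.*-zeroʳ c)
Σℤ-*ˡ {suc m} c f =
  trans (cong (_+_ (c * f zero)) (Σℤ-*ˡ c (f ∘ suc))) (sym (ℤP.*-distribˡ-+ c (f zero) _))

0≤i*j : ∀ {i j} → 0ℤ ≤ℤ i → 0ℤ ≤ℤ j → 0ℤ ≤ℤ i * j
0≤i*j {j = j} i≥0 j≥0 = ℤP.*-monoʳ-≤-nonNeg j {{ℤ.nonNegative j≥0}} i≥0

𝟙-nonneg : ∀ {n} (F : Subset n) v → 0ℤ ≤ℤ 𝟙 F v
𝟙-nonneg F v with F v
... | true  = +≤+ z≤n
... | false = +≤+ z≤n

𝟙≤1 : ∀ {n} (F : Subset n) v → 𝟙 F v ≤ℤ + 1
𝟙≤1 F v with F v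
... | true  = +≤+ (s≤s z≤n)
... | false = +≤+ z≤n

𝟙-true : ∀ {n} (F : Subset n) {v} → F v ≡ true → 𝟙 F v ≡ + 1
𝟙-true F = cong (if_then + 1 else 0ℤ)

𝟙-false : ∀ {n} (F : Subset n) {v} → F v ≡ false → 𝟙 F v ≡ 0ℤ
𝟙-false F = cong (if_then + 1 else 0ℤ)

∁≡true⇒≡false : ∀ {n} {F : Subset n} {v} → ∁ F v ≡ true → F v ≡ false
∁≡true⇒≡false = BoolP.not-injective

⟪𝟙⟦⟧,⟫-eval : ∀ {n} (x : Fin n) (f : Fn n) → ⟪ 𝟙 ⟦ x ⟧ , f ⟫ ≡ f x
⟪𝟙⟦⟧,⟫-eval {suc n} zero f =
  trans (cong₂ _+_ (ℤP.*-identityˡ (f zero)) (Σℤ-zero {n} (λ _ → refl))) (ℤP.+-identityʳ (f zero))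
⟪𝟙⟦⟧,⟫-eval (suc x) f =
  trans (ℤP.+-identityˡ _)
    (trans (Σℤ-cong (λ i → cong (λ b → (if b then + 1 else 0ℤ) * f (suc i)) (⌊⌋-map′ _ _ (i FinP.≟ x))))
           (⟪𝟙⟦⟧,⟫-eval x (f ∘ suc)))

⟪,𝟙⟫-nonneg : ∀ {n} {f : Fn n} (F : Subset n) → (∀ v → 0ℤ ≤ℤ f v) → 0ℤ ≤ℤ ⟪ f , 𝟙 F ⟫
⟪,𝟙⟫-nonneg F f≥0 = Σℤ-nonneg (λ v → 0≤i*j (f≥0 v) (𝟙-nonneg F v))

⟪,𝟙⟫-mono : ∀ {n} {f g : Fn n} {F H : Subset n} →
            (∀ v → F v ≡ true → H v ≡ true) → (∀ v → F v ≡ true → f v ≤ℤ g v) → (∀ v → 0ℤ ≤ℤ g v) →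
            ⟪ f , 𝟙 F ⟫ ≤ℤ ⟪ g , 𝟙 H ⟫
⟪,𝟙⟫-mono {f = f} {g} {F} {H} F⊆H f≤g g≥0 = Σℤ-mono-≤ termwise
  where
  termwise : ∀ v → f v * 𝟙 F v ≤ℤ g v * 𝟙 H v
  termwise v with F v in Fv
  ... | false = subst (_≤ℤ g v * 𝟙 H v) (sym (ℤP.*-zeroʳ (f v))) (0≤i*j (g≥0 v) (𝟙-nonneg H v))
  ... | true  rewrite F⊆H v Fv = ℤP.*-monoʳ-≤-nonNeg (+ 1) (f≤g v Fv)

⟪,𝟙⟫-pos : ∀ {n} {f : Fn n} {F : Subset n} → (∀ v → 0ℤ ≤ℤ f v) →
           ∀ {a} → F a ≡ true → 0ℤ <ℤ f a → 0ℤ <ℤ ⟪ f , 𝟙 F ⟫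
⟪,𝟙⟫-pos {f = f} {F} f≥0 {a} Fa fa>0 =
  ℤP.<-≤-trans (subst (0ℤ <ℤ_) (sym fa𝟙≡fa) fa>0) (Σℤ-term≤ (λ v → 0≤i*j (f≥0 v) (𝟙-nonneg F v)) a)
  where
  fa𝟙≡fa : f a * 𝟙 F a ≡ f a
  fa𝟙≡fa = trans (cong (f a *_) (𝟙-true F Fa)) (ℤP.*-identityʳ (f a))

⟪,𝟙⟫-pos⇒inhabited : ∀ {n} {f : Fn n} {F : Subset n} → 0ℤ <ℤ ⟪ f , 𝟙 F ⟫ → ∃ λ v → F v ≡ true
⟪,𝟙⟫-pos⇒inhabited {f = f} {F} pos with FinP.any? (λ v → F v BoolP.≟ true)
... | yes inhabited = inhabited
... | no  empty     = contradiction pos (ℤP.<-irrefl (sym (Σℤ-zero termwise)))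
  where
  termwise : ∀ v → f v * 𝟙 F v ≡ 0ℤ
  termwise v with F v in Fv
  ... | true  = contradiction (v , Fv) empty
  ... | false = ℤP.*-zeroʳ (f v)

module _ {n d : ℕ} (ρ : Fin d → Permutation′ n) where

  Top-nonneg : ∀ {f} → (∀ v → 0ℤ ≤ℤ f v) → ∀ v → 0ℤ ≤ℤ Top ρ f v
  Top-nonneg f≥0 v = Σℤ-nonneg (λ i → f≥0 (ρ i ⟨$⟩ˡ v))

  Top-𝟙-full : ∀ v → Top ρ (𝟙 full) v ≡ + d
  Top-𝟙-full v = trans (Σℤ-const {d} (+ 1)) (ℤP.*-identityʳ (+ d))

  vol-Top-nonneg : ∀ F → 0ℤ ≤ℤ vol (Top ρ) F
  vol-Top-nonneg F = ⟪,𝟙⟫-nonneg F (Top-nonneg (𝟙-nonneg full))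

  vol-Top-mono : ∀ {F H} → (∀ v → F v ≡ true → H v ≡ true) → vol (Top ρ) F ≤ℤ vol (Top ρ) H
  vol-Top-mono F⊆H = ⟪,𝟙⟫-mono F⊆H (λ _ _ → ℤP.≤-refl) (Top-nonneg (𝟙-nonneg full))

  vol-Top-pos : 0 < d → ∀ {F a} → F a ≡ true → 0ℤ <ℤ vol (Top ρ) F
  vol-Top-pos (s≤s _) {a = a} Fa =
    ⟪,𝟙⟫-pos (Top-nonneg (𝟙-nonneg full)) Fa (subst (0ℤ <ℤ_) (sym (Top-𝟙-full a)) (+<+ (s≤s z≤n)))

  -- (Top ρ ²) (𝟙 full) v unfolds to a sum of d copies of the constant Top ρ (𝟙 full) v.
  vol-Top² : ∀ F → vol (Top ρ ²) F ≡ + d * vol (Top ρ) F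
  vol-Top² F = begin
    Σℤ (λ v → (Top ρ ²) (𝟙 full) v * 𝟙 F v)          ≡⟨ Σℤ-cong (λ v → cong (_* 𝟙 F v) (Σℤ-const {d} (Top ρ (𝟙 full) v))) ⟩
    Σℤ (λ v → (+ d * Top ρ (𝟙 full) v) * 𝟙 F v)      ≡⟨ Σℤ-cong (λ v → ℤP.*-assoc (+ d) _ (𝟙 F v)) ⟩
    Σℤ (λ v → + d * (Top ρ (𝟙 full) v * 𝟙 F v))      ≡⟨ Σℤ-*ˡ (+ d) (λ v → Top ρ (𝟙 full) v * 𝟙 F v) ⟩
    + d * vol (Top ρ) F                              ∎
    where open ≡-Reasoning

  proper-if-vol< : ∀ {F a} → F a ≡ true → vol (Top ρ) F <ℤ vol (Top ρ) (∁ F) → Proper F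
  proper-if-vol< {F} {a} Fa F<∁F
    with ⟪,𝟙⟫-pos⇒inhabited {f = Top ρ (𝟙 full)} {F = ∁ F} (ℤP.≤-<-trans (vol-Top-nonneg F) F<∁F)
  ... | u , ∁Fu = (a , Fa) , (u , ∁≡true⇒≡false {F = F} ∁Fu)

module _ {n d : ℕ} (ρ : Fin d → Permutation′ n) (self-adjoint : SelfAdjoint (Top ρ)) (X : Subset n) where

  𝒩-Top : ∀ v → 𝒩 (Top ρ) X v ≡ not ⌊ Top ρ (𝟙 X) v ℤP.≟ 0ℤ ⌋
  𝒩-Top v = cong (λ z → not ⌊ z ℤP.≟ 0ℤ ⌋)
                 (trans (self-adjoint (𝟙 ⟦ v ⟧) (𝟙 X)) (⟪𝟙⟦⟧,⟫-eval v (Top ρ (𝟙 X))))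

  ∉𝒩⇒Top𝟙≡0 : ∀ {v} → 𝒩 (Top ρ) X v ≡ false → Top ρ (𝟙 X) v ≡ 0ℤ
  ∉𝒩⇒Top𝟙≡0 {v} v∉𝒩 with Top ρ (𝟙 X) v ℤP.≟ 0ℤ | 𝒩-Top v
  ... | yes Top𝟙≡0 | _   = Top𝟙≡0
  ... | no  _      | v∈𝒩 = contradiction (trans (sym v∈𝒩) v∉𝒩) λ ()

  Top𝟙≡0⇒neighbours∉ : ∀ {v} → Top ρ (𝟙 X) v ≡ 0ℤ → ∀ i → X (ρ i ⟨$⟩ˡ v) ≡ false
  Top𝟙≡0⇒neighbours∉ {v} Top𝟙≡0 i = BoolP.¬-not λ w∈X →
    contradiction (subst₂ _≤ℤ_ (𝟙-true X w∈X) Top𝟙≡0 (Σℤ-term≤ (λ j → 𝟙-nonneg X (ρ j ⟨$⟩ˡ v)) i))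
                  λ { (+≤+ ()) }

  𝟙∪𝒩≤Top𝟙 : ∀ {w} → X w ≡ false → 𝟙 (X ∪ 𝒩 (Top ρ) X) w ≤ℤ Top ρ (𝟙 X) w
  𝟙∪𝒩≤Top𝟙 {w} w∉X with Top ρ (𝟙 X) w ℤP.≟ 0ℤ | 𝒩-Top w
  ... | yes _  | w∉𝒩 = subst (_≤ℤ Top ρ (𝟙 X) w)
                           (sym (𝟙-false (X ∪ 𝒩 (Top ρ) X) (trans (cong (_∨ 𝒩 (Top ρ) X w) w∉X) w∉𝒩)))
                           (Top-nonneg ρ (𝟙-nonneg X) w)
  ... | no ≢0 | _    = ℤP.≤-trans (𝟙≤1 (X ∪ 𝒩 (Top ρ) X) w)
                           (ℤP.i<j⇒suc[i]≤j (ℤP.≤∧≢⇒< (Top-nonneg ρ (𝟙-nonneg X) w) (≢0 ∘ sym)))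

  Top𝟙∪𝒩≤Top²𝟙 : ∀ {v} → (X ∪ 𝒩 (Top ρ) X) v ≡ false → Top ρ (𝟙 (X ∪ 𝒩 (Top ρ) X)) v ≤ℤ (Top ρ ²) (𝟙 X) v
  Top𝟙∪𝒩≤Top²𝟙 {v} v∉B =
    Σℤ-mono-≤ (λ i → 𝟙∪𝒩≤Top𝟙 (Top𝟙≡0⇒neighbours∉ (∉𝒩⇒Top𝟙≡0 (BoolP.∨-conicalʳ _ _ v∉B)) i))

  ∂-∪𝒩≤∂² : ∂ (Top ρ) (X ∪ 𝒩 (Top ρ) X) ≤ℤ ∂ (Top ρ ²) X
  ∂-∪𝒩≤∂² = ⟪,𝟙⟫-mono ∁B⊆∁X (λ v v∉B → Top𝟙∪𝒩≤Top²𝟙 (∁≡true⇒≡false {F = X ∪ 𝒩 (Top ρ) X} v∉B))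
                       (Top-nonneg ρ (Top-nonneg ρ (𝟙-nonneg X)))
    where
    ∁B⊆∁X : ∀ v → ∁ (X ∪ 𝒩 (Top ρ) X) v ≡ true → ∁ X v ≡ true
    ∁B⊆∁X v v∉B = cong not (BoolP.∨-conicalˡ _ _ (∁≡true⇒≡false {F = X ∪ 𝒩 (Top ρ) X} v∉B))

module _ {G : Group 0ℓ 0ℓ} {n : ℕ} (α : Action G n) where
  open Group G using (Carrier; _≈_; _∙_; ε; _⁻¹; inverseˡ; inverseʳ)
  open Action α

  act-cancel : ∀ {g h} → g ∙ h ≈ ε → ∀ v → act g (act h v) ≡ v
  act-cancel gh≈ε v = trans (sym (act-∙ _ _ v)) (trans (act-cong gh≈ε v) (act-ε v))

  act⁻¹-permutation : Carrier → Permutation′ n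
  act⁻¹-permutation g = permutation (act (g ⁻¹)) (act g) (act-cancel (inverseˡ g)) (act-cancel (inverseʳ g))

  ⟪⟫-actFn : ∀ g (f h : Fn n) → ⟪ actFn α g f , actFn α g h ⟫ ≡ ⟪ f , h ⟫
  ⟪⟫-actFn g f h = Σℤ-permute (λ v → f v * h v) (act⁻¹-permutation g)

  ∂-actSet : ∀ S → CommutesWith α S → ∀ g A → ∂ S (actSet α g A) ≡ ∂ S A
  ∂-actSet S commutes g A =
    trans (Σℤ-cong (λ v → cong (_* 𝟙 (∁ A) (act (g ⁻¹) v)) (sym (commutes g (𝟙 A) v))))
          (⟪⟫-actFn g (S (𝟙 A)) (𝟙 (∁ A)))

  -- Top ρ (𝟙 full) does not depend on its argument, so it is definitionally fixed by the action.
  vol-Top-actSet : ∀ {d} (ρ : Fin d → Permutation′ n) g A → vol (Top ρ) (actSet α g A) ≡ vol (Top ρ) A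
  vol-Top-actSet ρ g A = ⟪⟫-actFn g (Top ρ (𝟙 full)) (𝟙 A)

toℚ≡fromℤ : ∀ z → toℚ z ≡ fromℤ z
toℚ≡fromℤ z = ℚP.↥p/↧p≡p (fromℤ z)

toℚ-* : ∀ i j → toℚ (i * j) ≡ toℚ i *ℚ toℚ j
toℚ-* i j = sym (cong₂ _*ℚ_ (toℚ≡fromℤ i) (toℚ≡fromℤ j))

toℚ-mono-≤ : ∀ {i j} → i ≤ℤ j → toℚ i ≤ℚ toℚ j
toℚ-mono-≤ {i} {j} i≤j = subst₂ _≤ℚ_ (sym (toℚ≡fromℤ i)) (sym (toℚ≡fromℤ j))
  (ℚ.*≤* (subst₂ _≤ℤ_ (sym (ℤP.*-identityʳ i)) (sym (ℤP.*-identityʳ j)) i≤j))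

toℚ-mono-< : ∀ {i j} → i <ℤ j → toℚ i <ℚ toℚ j
toℚ-mono-< {i} {j} i<j = subst₂ _<ℚ_ (sym (toℚ≡fromℤ i)) (sym (toℚ≡fromℤ j))
  (ℚ.*<* (subst₂ _<ℤ_ (sym (ℤP.*-identityʳ i)) (sym (ℤP.*-identityʳ j)) i<j))

h*b≤c*a⇒h≤c : ∀ {a b c h : ℚ} → 0ℚ <ℚ a → a ≤ℚ b → 0ℚ ≤ℚ c *ℚ a → h *ℚ b ≤ℚ c *ℚ a → h ≤ℚ c
h*b≤c*a⇒h≤c {a} {b} {c} {h} a>0 a≤b ca≥0 hb≤ca with 0ℚ ℚP.≤? c
... | yes c≥0 = ℚP.*-cancelʳ-≤-pos b (ℚP.≤-trans hb≤ca (ℚP.*-monoˡ-≤-nonNeg c a≤b))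
  where
  instance
    _ = ℚ.nonNegative c≥0
    _ = ℚ.positive (ℚP.<-≤-trans a>0 a≤b)
... | no  c≱0 = contradiction (ℚP.<-≤-trans (ℚP.negative⁻¹ (c *ℚ a) {{ℚP.neg*pos⇒neg c a}}) ca≥0) (ℚP.<-irrefl refl)
  where
  instance
    _ = ℚ.negative (ℚP.≰⇒> c≱0)
    _ = ℚ.positive a>0

cheeger-bound : ∀ {n} (T : Fn n → Fn n) (h : ℚ) {F} → IsCheeger T h → Proper F → vol T F ≤ℤ vol T (∁ F) →
                h *ℚ toℚ (vol T F) ≤ℚ toℚ (∂ T F)
cheeger-bound T h {F} (_ , lower-bound) proper F≤∁F =
  subst (λ z → h *ℚ toℚ z ≤ℚ toℚ (∂ T F)) (ℤP.i≤j⇒i⊓j≡i F≤∁F) (lower-bound F proper)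

lemma4p4 :
  (n : ℕ) → 2 ≤ n → (d : ℕ) → 0 < d → (ρ : Fin d → Permutation′ n) →
  let T = Top ρ in
  SelfAdjoint T →
  (∀ u v → + 0 ≤ℤ ⟪ T (𝟙 ⟦ v ⟧) , 𝟙 ⟦ u ⟧ ⟫) →
  (∀ u → vol T ⟦ u ⟧ ≡ + d) →
  ¬ IsEigenvalue T (- (+ d)) →
  (G : Group 0ℓ 0ℓ) → (α : Action G n) →
  Transitive α →
  CommutesWith α (T ²) →
  (∀ (H : Group.Carrier G → Set) → IsSubgroup G H → IndexTwo G H → ¬ TransitiveOn α H) →
  (ψ : ℚ) → IsCheeger (T ²) ψ →
  (hT : ℚ) → IsCheeger T hT →
  (A : Subset n) → Proper A →
  vol (T ²) A ≤ℤ vol (T ²) (∁ A) →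
  toℚ (∂ (T ²) A) ≡ ψ *ℚ toℚ (vol (T ²) A) →
  ψ *ℚ toℚ (+ d) <ℚ hT →
  ∀ (g : Group.Carrier G) →
    let B = actSet α g A ∪ 𝒩 T (actSet α g A) in
    vol T (∁ B) ≤ℤ vol T B
lemma4p4 n _ d d>0 ρ self-adjoint _ _ _ G α _ commutes _ ψ _ hT cheeger-T A ((a , a∈A) , _) _ ∂²A≡ψvol²A ψd<hT g =
  ℤP.≮⇒≥ λ B<∁B → ℚP.<-irrefl refl (ℚP.<-≤-trans ψd<hT
    (h*b≤c*a⇒h≤c volA>0 volA≤volB ∂²A≥0
      (ℚP.≤-trans (cheeger-bound (Top ρ) hT cheeger-T (proper-if-vol< ρ ga∈B B<∁B) (ℤP.<⇒≤ B<∁B)) ∂B≤∂²A)))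
  where
  open Action α using (act)
  open ≡-Reasoning
  X = actSet α g A
  B = X ∪ 𝒩 (Top ρ) X

  ga∈B : B (act g a) ≡ true
  ga∈B = cong (_∨ 𝒩 (Top ρ) X (act g a)) (trans (cong A (act-cancel α (Group.inverseˡ G g) a)) a∈A)

  volA>0 : 0ℚ <ℚ toℚ (vol (Top ρ) A)
  volA>0 = toℚ-mono-< (vol-Top-pos ρ d>0 a∈A)

  volA≤volB : toℚ (vol (Top ρ) A) ≤ℚ toℚ (vol (Top ρ) B)
  volA≤volB = toℚ-mono-≤ (subst (_≤ℤ vol (Top ρ) B) (vol-Top-actSet α ρ g A)
                                (vol-Top-mono ρ (λ v v∈X → cong (_∨ 𝒩 (Top ρ) X v) v∈X)))

  ∂²A≡ψdvolA : toℚ (∂ (Top ρ ²) A) ≡ (ψ *ℚ toℚ (+ d)) *ℚ toℚ (vol (Top ρ) A)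
  ∂²A≡ψdvolA = begin
    toℚ (∂ (Top ρ ²) A)                      ≡⟨ ∂²A≡ψvol²A ⟩
    ψ *ℚ toℚ (vol (Top ρ ²) A)               ≡⟨ cong (λ z → ψ *ℚ toℚ z) (vol-Top² ρ A) ⟩
    ψ *ℚ toℚ (+ d * vol (Top ρ) A)           ≡⟨ cong (ψ *ℚ_) (toℚ-* (+ d) (vol (Top ρ) A)) ⟩
    ψ *ℚ (toℚ (+ d) *ℚ toℚ (vol (Top ρ) A))  ≡⟨ sym (ℚP.*-assoc ψ (toℚ (+ d)) (toℚ (vol (Top ρ) A))) ⟩
    (ψ *ℚ toℚ (+ d)) *ℚ toℚ (vol (Top ρ) A)  ∎

  ∂²A≥0 : 0ℚ ≤ℚ (ψ *ℚ toℚ (+ d)) *ℚ toℚ (vol (Top ρ) A)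
  ∂²A≥0 = subst (0ℚ ≤ℚ_) ∂²A≡ψdvolA
                (toℚ-mono-≤ (⟪,𝟙⟫-nonneg (∁ A) (Top-nonneg ρ (Top-nonneg ρ (𝟙-nonneg A)))))

  ∂B≤∂²A : toℚ (∂ (Top ρ) B) ≤ℚ (ψ *ℚ toℚ (+ d)) *ℚ toℚ (vol (Top ρ) A)
  ∂B≤∂²A = subst (toℚ (∂ (Top ρ) B) ≤ℚ_) ∂²A≡ψdvolA
                 (toℚ-mono-≤ (subst (∂ (Top ρ) B ≤ℤ_) (∂-actSet α (Top ρ ²) commutes g A) (∂-∪𝒩≤∂² ρ self-adjoint X)))
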